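{- Let $\sigma$ be a separable permutation and let $u$, $w$, $w'$ be increasing subsequences of $\sigma$ such that $w$ and $w'$ are disjoint. Then there exist two disjoint increasing subsequences $\alpha$ and $\beta$ of $\sigma$ such that $\alpha\cup\beta=w\cup w'$ and $\alpha\cap u=\emptyset$.
   Context: A permutation is separable if it contains neither of the patterns $3142$ and $2413$ (a permutation $\tau$ contains the pattern $\pi\in S_m$ if some length-$m$ subsequence of $\tau$ is in the same relative order as $\pi$). Subsequences of a permutation are identified with the corresponding sets of positions (equivalently, of entries), so unions, intersections and disjointness of subsequences are taken as sets. -}

module Defs where

open import Data.Nat using (ℕ)
open import Data.Fin using (Fin; _<_)
open import Data.Fin.Subset using (Subset; _∈_; _∩_; ⊥)
open import Data.Fin.Permutation using (Permutation′; _⟨$⟩ʳ_)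
open import Data.Product using (Σ; _×_; ∃-syntax)
open import Relation.Nullary using (¬_)
open import Relation.Binary.PropositionalEquality using (_≡_)

-- A permutation σ of [n]; position i carries the entry σ ⟨$⟩ʳ i.
-- Subsequences are identified with their sets of positions.

Contains3142 : ∀ {n} → Permutation′ n → Set
Contains3142 {n} σ = ∃[ i₁ ] ∃[ i₂ ] ∃[ i₃ ] ∃[ i₄ ]
  ((i₁ < i₂) × (i₂ < i₃) × (i₃ < i₄) ×
   (σ ⟨$⟩ʳ i₂ < σ ⟨$⟩ʳ i₄) × (σ ⟨$⟩ʳ i₄ < σ ⟨$⟩ʳ i₁) × (σ ⟨$⟩ʳ i₁ < σ ⟨$⟩ʳ i₃))

Contains2413 : ∀ {n} → Permutation′ n → Set
Contains2413 {n} σ = ∃[ i₁ ] ∃[ i₂ ] ∃[ i₃ ] ∃[ i₄ ]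
  ((i₁ < i₂) × (i₂ < i₃) × (i₃ < i₄) ×
   (σ ⟨$⟩ʳ i₃ < σ ⟨$⟩ʳ i₁) × (σ ⟨$⟩ʳ i₁ < σ ⟨$⟩ʳ i₄) × (σ ⟨$⟩ʳ i₄ < σ ⟨$⟩ʳ i₂))

Separable : ∀ {n} → Permutation′ n → Set
Separable σ = ¬ Contains3142 σ × ¬ Contains2413 σ

Increasing : ∀ {n} → Permutation′ n → Subset n → Set
Increasing σ S = ∀ i j → i ∈ S → j ∈ S → i < j → σ ⟨$⟩ʳ i < σ ⟨$⟩ʳ j

Disjoint : ∀ {n} → Subset n → Subset n → Set
Disjoint A B = A ∩ B ≡ ⊥

module Submission where

open import Defs
open import Data.Nat using (ℕ)
open import Data.Fin.Subset using (Subset; _∪_)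
open import Data.Fin.Permutation using (Permutation′)
open import Data.Product using (_×_; ∃-syntax)
open import Relation.Binary.PropositionalEquality using (_≡_)

open import Data.Fin using (Fin; _<_; _≟_; _<?_)
open import Data.Fin.Properties using (<-cmp; <-trans; <-irrefl; <-asym; any?)
open import Data.Fin.Subset using (_∈_; _∉_; _∩_; ∁; ⊤)
open import Data.Fin.Subset.Properties
  using (_∈?_; x∈p∪q⁻; x∈p∩q⁺; x∈p∩q⁻; x∈p⇒x∉∁p; x∈∁p⇒x∉p;
         Empty-unique; ∩-distribˡ-∪; ∪-inverseʳ; ∩-identityʳ)
open import Data.Fin.Permutation using (_⟨$⟩ʳ_)
open import Data.Vec using (tabulate)
open import Data.Vec.Properties using (lookup∘tabulate; []=⇒lookup; lookup⇒[]=)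
open import Data.Product using (∃; ∃₂; _,_; proj₁; proj₂)
open import Data.Sum using (_⊎_; inj₁; inj₂)
open import Data.Empty using (⊥; ⊥-elim)
open import Function using (_∘_)
open import Function.Bundles using (Injection)
open import Function.Properties.Inverse using (↔⇒↣)
open import Relation.Unary using (Pred; Decidable)
open import Relation.Nullary using (¬_; Dec; yes; no; does)
open import Relation.Nullary.Decidable using (_×-dec_; _⊎-dec_; ¬?; dec-true)
open import Relation.Binary using (tri<; tri≈; tri>)
open import Relation.Binary.PropositionalEquality using (refl; sym; trans; cong)
open Relation.Binary.PropositionalEquality.≡-Reasoning

-- Call positions i < j with σ(i) > σ(j) an inversion and view
-- the inversions as the edges of a graph on positions; a set of positions
-- is increasing iff it spans no edge.  S = w ∪ w′, a union of two
-- increasing sets, contains no 321 pattern.  The key fact (∼-path₃) is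
-- that for separable σ and any 321-free S, every path a ∼ b ∼ c ∼ d inside
-- S closes up to an edge a ∼ d, since otherwise a, b, c, d realise 2413 or
-- 3142; so each component of the inversion graph on S is complete
-- bipartite with increasing sides.  We choose one side per component: the
-- side adjacent to S ∩ u when the component meets u (u is increasing, so
-- it meets only one side), its upper-left side otherwise.  The chosen
-- points form α, the rest of S forms β.

select : ∀ {n ℓ} {P : Pred (Fin n) ℓ} → Decidable P → Subset n
select P? = tabulate (does ∘ P?)

∈-select⁺ : ∀ {n ℓ} {P : Pred (Fin n) ℓ} (P? : Decidable P) {x} → P x → x ∈ select P?
∈-select⁺ P? {x} px =
  lookup⇒[]= x (select P?) (trans (lookup∘tabulate (does ∘ P?) x) (dec-true (P? x) px))

∈-select⁻ : ∀ {n ℓ} {P : Pred (Fin n) ℓ} (P? : Decidable P) {x} → x ∈ select P? → P x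
∈-select⁻ P? {x} x∈ with P? x | trans (sym (lookup∘tabulate (does ∘ P?) x)) ([]=⇒lookup x∈)
... | yes px | _ = px
... | no _   | ()

module InversionGraph {n : ℕ} (σ : Permutation′ n) where

  _⇘_ : Fin n → Fin n → Set
  x ⇘ y = (x < y) × (σ ⟨$⟩ʳ y < σ ⟨$⟩ʳ x)

  _⇗_ : Fin n → Fin n → Set
  x ⇗ y = (x < y) × (σ ⟨$⟩ʳ x < σ ⟨$⟩ʳ y)

  _∼_ : Fin n → Fin n → Set
  x ∼ y = x ⇘ y ⊎ y ⇘ x

  ∼-sym : ∀ {x y} → x ∼ y → y ∼ x
  ∼-sym (inj₁ x⇘y) = inj₂ x⇘y
  ∼-sym (inj₂ y⇘x) = inj₁ y⇘x

  ⇘-trans : ∀ {x y z} → x ⇘ y → y ⇘ z → x ⇘ z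
  ⇘-trans (x<y , σy<σx) (y<z , σz<σy) = <-trans x<y y<z , <-trans σz<σy σy<σx

  _⇘?_ : ∀ x y → Dec (x ⇘ y)
  x ⇘? y = (x <? y) ×-dec (σ ⟨$⟩ʳ y <? σ ⟨$⟩ʳ x)

  _∼?_ : ∀ x y → Dec (x ∼ y)
  x ∼? y = (x ⇘? y) ⊎-dec (y ⇘? x)

  σ-injective : ∀ {x y} → σ ⟨$⟩ʳ x ≡ σ ⟨$⟩ʳ y → x ≡ y
  σ-injective = Injection.injective (↔⇒↣ σ)

  co-ordered : ∀ {x y} → ¬ x ≡ y → ¬ x ∼ y → x ⇗ y ⊎ y ⇗ x
  co-ordered {x} {y} x≢y x≁y with <-cmp x y | <-cmp (σ ⟨$⟩ʳ x) (σ ⟨$⟩ʳ y)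
  ... | tri≈ _ x≡y _ | _              = ⊥-elim (x≢y x≡y)
  ... | _            | tri≈ _ σx≡σy _ = ⊥-elim (x≢y (σ-injective σx≡σy))
  ... | tri< x<y _ _ | tri< σx<σy _ _ = inj₁ (x<y , σx<σy)
  ... | tri< x<y _ _ | tri> _ _ σy<σx = ⊥-elim (x≁y (inj₁ (x<y , σy<σx)))
  ... | tri> _ _ y<x | tri< σx<σy _ _ = ⊥-elim (x≁y (inj₂ (y<x , σx<σy)))
  ... | tri> _ _ y<x | tri> _ _ σy<σx = inj₂ (y<x , σy<σx)

  Independent : Subset n → Set
  Independent v = ∀ {x y} → x ∈ v → y ∈ v → ¬ x ⇘ y

  increasing⇒independent : ∀ {v} → Increasing σ v → Independent v
  increasing⇒independent inc {x} {y} x∈v y∈v (x<y , σy<σx) =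
    <-asym (inc x y x∈v y∈v x<y) σy<σx

  independent⇒increasing : ∀ {v} → Independent v → Increasing σ v
  independent⇒increasing indep x y x∈v y∈v x<y with <-cmp (σ ⟨$⟩ʳ x) (σ ⟨$⟩ʳ y)
  ... | tri< σx<σy _ _ = σx<σy
  ... | tri≈ _ σx≡σy _ = ⊥-elim (<-irrefl (σ-injective σx≡σy) x<y)
  ... | tri> _ _ σy<σx = ⊥-elim (indep x∈v y∈v (x<y , σy<σx))

  independent-∼ : ∀ {v x y} → Independent v → x ∈ v → y ∈ v → ¬ x ∼ y
  independent-∼ indep x∈v y∈v (inj₁ x⇘y) = indep x∈v y∈v x⇘y
  independent-∼ indep x∈v y∈v (inj₂ y⇘x) = indep y∈v x∈v y⇘x

  Free321 : Subset n → Set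
  Free321 S = ∀ {x y z} → x ∈ S → y ∈ S → z ∈ S → x ⇘ y → ¬ y ⇘ z

  -- A union of two increasing sets is 321-free (pigeonhole: two of the
  -- three points of a 321 would lie in the same increasing set).
  union-free321 : ∀ {v v′} → Increasing σ v → Increasing σ v′ → Free321 (v ∪ v′)
  union-free321 {v} {v′} inc inc′ x∈ y∈ z∈ x⇘y y⇘z =
    pigeonhole (x∈p∪q⁻ v v′ x∈) (x∈p∪q⁻ v v′ y∈) (x∈p∪q⁻ v v′ z∈)
    where
    indep : Independent v
    indep = increasing⇒independent inc
    indep′ : Independent v′
    indep′ = increasing⇒independent inc′
    x⇘z : _ ⇘ _
    x⇘z = ⇘-trans x⇘y y⇘z
    pigeonhole : _ ∈ v ⊎ _ ∈ v′ → _ ∈ v ⊎ _ ∈ v′ → _ ∈ v ⊎ _ ∈ v′ → ⊥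
    pigeonhole (inj₁ x∈v)  (inj₁ y∈v)  _           = indep x∈v y∈v x⇘y
    pigeonhole (inj₂ x∈v′) (inj₂ y∈v′) _           = indep′ x∈v′ y∈v′ x⇘y
    pigeonhole (inj₁ x∈v)  (inj₂ y∈v′) (inj₁ z∈v)  = indep x∈v z∈v x⇘z
    pigeonhole (inj₁ _)    (inj₂ y∈v′) (inj₂ z∈v′) = indep′ y∈v′ z∈v′ y⇘z
    pigeonhole (inj₂ x∈v′) (inj₁ _)    (inj₂ z∈v′) = indep′ x∈v′ z∈v′ x⇘z
    pigeonhole (inj₂ _)    (inj₁ y∈v)  (inj₁ z∈v)  = indep y∈v z∈v y⇘z

  module _ (sep : Separable σ) {S : Subset n} (free : Free321 S) where

    -- Two points a, c both above-left of b, with c also above-left of d, force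
    -- a ∼ d: the alternatives produce a 2413 on (a, c, b, d) or a 3142 on
    -- (c, d, a, b), while a ∼ c or b ∼ d would produce a 321.
    shared-corner : ∀ {a b c d} → a ∈ S → b ∈ S → c ∈ S → d ∈ S →
                    a ⇘ b → c ⇘ b → c ⇘ d → a ∼ d
    shared-corner {a} {b} {c} {d} a∈ b∈ c∈ d∈ a⇘b c⇘b c⇘d with a ≟ c | b ≟ d
    ... | yes refl | _        = inj₁ c⇘d
    ... | no _     | yes refl = inj₁ a⇘b
    ... | no a≢c   | no b≢d   = from-orders (co-ordered a≢c a≁c) (co-ordered b≢d b≁d)
      where
      a≁c : ¬ a ∼ c
      a≁c (inj₁ a⇘c) = free a∈ c∈ b∈ a⇘c c⇘b
      a≁c (inj₂ c⇘a) = free c∈ a∈ b∈ c⇘a a⇘b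
      b≁d : ¬ b ∼ d
      b≁d (inj₁ b⇘d) = free c∈ b∈ d∈ c⇘b b⇘d
      b≁d (inj₂ d⇘b) = free c∈ d∈ b∈ c⇘d d⇘b
      -- Positions a < c < b < d: a value of d above that of a gives 2413.
      positions-ascending : a < c → b < d → a < d → a ∼ d
      positions-ascending a<c b<d a<d with <-cmp (σ ⟨$⟩ʳ a) (σ ⟨$⟩ʳ d)
      ... | tri> _ _ σd<σa = inj₁ (a<d , σd<σa)
      ... | tri≈ _ σa≡σd _ = ⊥-elim (<-irrefl (σ-injective σa≡σd) a<d)
      ... | tri< σa<σd _ _ =
        ⊥-elim (proj₂ sep (a , c , b , d , a<c , proj₁ c⇘b , b<d ,
                           proj₂ a⇘b , σa<σd , proj₂ c⇘d))
      -- Case split on how the pairs (a, c) and (b, d) are ordered; if c is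
      -- left of a and d left of a, then (c, d, a, b) is a 3142.
      from-orders : a ⇗ c ⊎ c ⇗ a → b ⇗ d ⊎ d ⇗ b → a ∼ d
      from-orders (inj₁ (a<c , _)) (inj₂ (_ , σd<σb)) =
        inj₁ (<-trans a<c (proj₁ c⇘d) , <-trans σd<σb (proj₂ a⇘b))
      from-orders (inj₁ (a<c , _)) (inj₁ (b<d , _)) =
        positions-ascending a<c b<d (<-trans a<c (<-trans (proj₁ c⇘b) b<d))
      from-orders (inj₂ (c<a , σc<σa)) b-vs-d with <-cmp a d
      ... | tri< a<d _ _ = inj₁ (a<d , <-trans (proj₂ c⇘d) σc<σa)
      ... | tri≈ _ refl _ = ⊥-elim (<-asym (proj₂ c⇘d) σc<σa)
      ... | tri> _ _ d<a with b-vs-d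
      ...   | inj₁ (b<d , _) = ⊥-elim (<-asym b<d (<-trans d<a (proj₁ a⇘b)))
      ...   | inj₂ (_ , σd<σb) =
        ⊥-elim (proj₁ sep (c , d , a , b , proj₁ c⇘d , d<a , proj₁ a⇘b ,
                           σd<σb , proj₂ c⇘b , σc<σa))


    -- Inside S every path of length three closes up: a ∼ b ∼ c ∼ d ⇒ a ∼ d.
    -- (Together with triangle-freeness this says each component of the
    -- inversion graph on S is complete bipartite.)
    ∼-path₃ : ∀ {a b c d} → a ∈ S → b ∈ S → c ∈ S → d ∈ S →
              a ∼ b → b ∼ c → c ∼ d → a ∼ d
    ∼-path₃ a∈ b∈ c∈ d∈ (inj₁ a⇘b) (inj₁ b⇘c) _ = ⊥-elim (free a∈ b∈ c∈ a⇘b b⇘c)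
    ∼-path₃ a∈ b∈ c∈ d∈ (inj₁ a⇘b) (inj₂ c⇘b) (inj₁ c⇘d) =
      shared-corner a∈ b∈ c∈ d∈ a⇘b c⇘b c⇘d
    ∼-path₃ a∈ b∈ c∈ d∈ (inj₁ a⇘b) (inj₂ c⇘b) (inj₂ d⇘c) = ⊥-elim (free d∈ c∈ b∈ d⇘c c⇘b)
    ∼-path₃ a∈ b∈ c∈ d∈ (inj₂ b⇘a) (inj₂ c⇘b) _ = ⊥-elim (free c∈ b∈ a∈ c⇘b b⇘a)
    ∼-path₃ a∈ b∈ c∈ d∈ (inj₂ b⇘a) (inj₁ b⇘c) (inj₁ c⇘d) = ⊥-elim (free b∈ c∈ d∈ b⇘c c⇘d)
    ∼-path₃ a∈ b∈ c∈ d∈ (inj₂ b⇘a) (inj₁ b⇘c) (inj₂ d⇘c) =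
      ∼-sym (shared-corner d∈ c∈ b∈ a∈ d⇘c b⇘c b⇘a)

    module _ {u : Subset n} (inc-u : Increasing σ u) where

      Near : Fin n → Set
      Near x = ∃ λ t → t ∈ S ∩ u × x ∼ t

      Far : Fin n → Set
      Far x = ∃₂ λ y t → y ∈ S × t ∈ S ∩ u × x ∼ y × y ∼ t

      Leading : Fin n → Set
      Leading x = ∃ λ y → y ∈ S × x ⇘ y

      -- The side chosen for α: in a component meeting u, the side adjacent
      -- to u; in a component avoiding u, its upper-left side.
      Chosen : Fin n → Set
      Chosen x = x ∉ u × (Near x ⊎ (Leading x × ¬ Far x))

      Near? : Decidable Near
      Near? x = any? λ t → (t ∈? S ∩ u) ×-dec (x ∼? t)

      Far? : Decidable Far
      Far? x = any? λ y → any? λ t →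
        (y ∈? S) ×-dec ((t ∈? S ∩ u) ×-dec ((x ∼? y) ×-dec (y ∼? t)))

      Leading? : Decidable Leading
      Leading? x = any? λ y → (y ∈? S) ×-dec (x ⇘? y)

      Chosen? : Decidable Chosen
      Chosen? x = ¬? (x ∈? u) ×-dec (Near? x ⊎-dec (Leading? x ×-dec ¬? (Far? x)))

      indep-u : Independent u
      indep-u = increasing⇒independent inc-u

      S∩u-independent : ∀ {t t′} → t ∈ S ∩ u → t′ ∈ S ∩ u → ¬ t ∼ t′
      S∩u-independent t∈ t′∈ =
        independent-∼ indep-u (proj₂ (x∈p∩q⁻ S u t∈)) (proj₂ (x∈p∩q⁻ S u t′∈))

      -- No inversion joins two chosen points: two points near u would close a
      -- path t ∼ x ∼ y ∼ t′ between points of u; a point near u makes its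
      -- neighbour far from u; two leading points cannot form x ⇘ y ⇘ z.
      chosen-independent : ∀ {x y} → x ∈ S → y ∈ S → Chosen x → Chosen y → ¬ x ⇘ y
      chosen-independent x∈ y∈ (_ , inj₁ (t , t∈ , x∼t)) (_ , inj₁ (t′ , t′∈ , y∼t′)) x⇘y =
        S∩u-independent t∈ t′∈
          (∼-path₃ (proj₁ (x∈p∩q⁻ S u t∈)) x∈ y∈ (proj₁ (x∈p∩q⁻ S u t′∈))
                   (∼-sym x∼t) (inj₁ x⇘y) y∼t′)
      chosen-independent {x} x∈ y∈ (_ , inj₁ (t , t∈ , x∼t)) (_ , inj₂ (_ , ¬far-y)) x⇘y =
        ¬far-y (x , t , x∈ , t∈ , inj₂ x⇘y , x∼t)
      chosen-independent {y = y} x∈ y∈ (_ , inj₂ (_ , ¬far-x)) (_ , inj₁ (t , t∈ , y∼t)) x⇘y =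
        ¬far-x (y , t , y∈ , t∈ , inj₁ x⇘y , y∼t)
      chosen-independent x∈ y∈ (_ , inj₂ _) (_ , inj₂ ((z , z∈ , y⇘z) , _)) x⇘y =
        free x∈ y∈ z∈ x⇘y y⇘z

      -- No inversion joins two unchosen points of S: if one endpoint lies in
      -- u the other is near u; otherwise x is leading, so it is chosen unless
      -- far from u, in which case ∼-path₃ makes y near u.
      unchosen-independent : ∀ {x y} → x ∈ S → y ∈ S → ¬ Chosen x → ¬ Chosen y → ¬ x ⇘ y
      unchosen-independent {x} {y} x∈ y∈ ¬cx ¬cy x⇘y with x ∈? u | y ∈? u
      ... | yes x∈u | yes y∈u = indep-u x∈u y∈u x⇘y
      ... | yes x∈u | no y∉u  = ¬cy (y∉u , inj₁ (x , x∈p∩q⁺ (x∈ , x∈u) , inj₂ x⇘y))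
      ... | no x∉u  | yes y∈u = ¬cx (x∉u , inj₁ (y , x∈p∩q⁺ (y∈ , y∈u) , inj₁ x⇘y))
      ... | no x∉u  | no y∉u with Far? x
      ...   | no ¬far-x = ¬cx (x∉u , inj₂ ((y , y∈ , x⇘y) , ¬far-x))
      ...   | yes (z , t , z∈ , t∈ , x∼z , z∼t) =
        ¬cy (y∉u , inj₁ (t , t∈ ,
          ∼-path₃ y∈ x∈ z∈ (proj₁ (x∈p∩q⁻ S u t∈)) (inj₂ x⇘y) x∼z z∼t))

      chosen : Subset n
      chosen = select Chosen?

      α β : Subset n
      α = S ∩ chosen
      β = S ∩ ∁ chosen

      α-increasing : Increasing σ α
      α-increasing = independent⇒increasing λ {x} {y} x∈α y∈α →
        let (x∈S , x∈c) = x∈p∩q⁻ S chosen x∈α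
            (y∈S , y∈c) = x∈p∩q⁻ S chosen y∈α
        in chosen-independent x∈S y∈S (∈-select⁻ Chosen? x∈c) (∈-select⁻ Chosen? y∈c)

      unchosen : ∀ {x} → x ∈ ∁ chosen → ¬ Chosen x
      unchosen x∈∁c = x∈∁p⇒x∉p x∈∁c ∘ ∈-select⁺ Chosen?

      β-increasing : Increasing σ β
      β-increasing = independent⇒increasing λ {x} {y} x∈β y∈β →
        let (x∈S , x∉c) = x∈p∩q⁻ S (∁ chosen) x∈β
            (y∈S , y∉c) = x∈p∩q⁻ S (∁ chosen) y∈β
        in unchosen-independent x∈S y∈S (unchosen x∉c) (unchosen y∉c)

      α∪β≡S : α ∪ β ≡ S
      α∪β≡S = begin
        (S ∩ chosen) ∪ (S ∩ ∁ chosen) ≡⟨ sym (∩-distribˡ-∪ S chosen (∁ chosen)) ⟩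
        S ∩ (chosen ∪ ∁ chosen)       ≡⟨ cong (S ∩_) (∪-inverseʳ chosen) ⟩
        S ∩ ⊤                         ≡⟨ ∩-identityʳ S ⟩
        S                             ∎

      α-β-disjoint : Disjoint α β
      α-β-disjoint = Empty-unique λ (x , x∈α∩β) →
        let (x∈α , x∈β) = x∈p∩q⁻ α β x∈α∩β
        in x∈p⇒x∉∁p (proj₂ (x∈p∩q⁻ S chosen x∈α)) (proj₂ (x∈p∩q⁻ S (∁ chosen) x∈β))

      α-u-disjoint : Disjoint α u
      α-u-disjoint = Empty-unique λ (x , x∈α∩u) →
        let (x∈α , x∈u) = x∈p∩q⁻ α u x∈α∩u
        in proj₁ (∈-select⁻ Chosen? (proj₂ (x∈p∩q⁻ S chosen x∈α))) x∈u

      split : ∃[ α ] ∃[ β ] (Increasing σ α × Increasing σ β × Disjoint α β ×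
                (α ∪ β ≡ S) × Disjoint α u)
      split = α , β , α-increasing , β-increasing , α-β-disjoint , α∪β≡S , α-u-disjoint

lemma2p2 : (n : ℕ) (σ : Permutation′ n) → Separable σ →
    (u w w′ : Subset n) → Increasing σ u → Increasing σ w → Increasing σ w′ →
    Disjoint w w′ →
    ∃[ α ] ∃[ β ] (Increasing σ α × Increasing σ β × Disjoint α β ×
    (α ∪ β ≡ w ∪ w′) × Disjoint α u)
lemma2p2 n σ sep u w w′ inc-u inc-w inc-w′ _ =
  split sep (union-free321 inc-w inc-w′) inc-u
  where open InversionGraph σ
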